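{- Let $U,U'\in T_p$ and $V,V'\in T_q$ be standard Young tableaux with $U\leq U'$ and $V\leq V'$ in the Taskin weak order. Then $V\bigtriangleup U\leq V'\bigtriangleup U'$ in the Taskin weak order on $T_{p+q}$.
   Context: $T_n$ is the set of standard Young tableaux with entries $1,\ldots,n$; $P(\sigma)$ denotes the insertion tableau of $\sigma\in S_n$ under the Robinson–Schensted correspondence (so $P(\sigma)=P(\tau)$ iff $\sigma,\tau$ are plactic (Knuth) equivalent). Permutations are words; the right weak order on $S_n$ is $u\leq v$ iff every inversion $(j,i)$ ($j>i$, $j$ left of $i$) of $u$ is an inversion of $v$. The Taskin weak order on $T_n$ is the transitive closure of the relation: $U\leq V$ if there exist $u\leq v$ in $S_n$ with $P(u)=U$, $P(v)=V$ (it is a partial order). For permutations $u\in S_p$, $v\in S_q$, $v\bigtriangleup u=\bar v u$ (concatenation) with $\bar v$ equal to $v$ with $p$ added to each letter; for tableaux $U\in T_p$, $V\in T_q$, $V\bigtriangleup U:=P(v\bigtriangleup u)$ for any $u,v$ with $P(u)=U$, $P(v)=V$ (this is well defined). -}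

module Defs where

open import Data.Nat using (ℕ; zero; suc; _+_; _<_; _≤_; _>_; _<?_)
open import Data.List using (List; []; _∷_; _++_; map; upTo; length; concat; foldl; [_])
open import Data.List.Relation.Binary.Permutation.Propositional using (_↭_)
open import Data.Maybe using (Maybe; just; nothing)
open import Data.Product using (Σ; _×_; _,_; ∃-syntax)
open import Relation.Nullary using (yes; no)
open import Relation.Binary.PropositionalEquality using (_≡_)
open import Relation.Binary.Construct.Closure.Transitive using (TransClosure)

range1 : ℕ → List ℕ
range1 n = map suc (upTo n)

IsPerm : ℕ → List ℕ → Set
IsPerm n w = w ↭ range1 n

Inversion : List ℕ → ℕ → ℕ → Set
Inversion w a b = b < a × ∃[ xs ] ∃[ ys ] ∃[ zs ] (w ≡ xs ++ a ∷ ys ++ b ∷ zs)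

_≤w_ : List ℕ → List ℕ → Set
u ≤w v = ∀ a b → Inversion u a b → Inversion v a b

-- v △ u = v̄ u, where v̄ adds p to each letter of v (p = size of u)
shiftConcat : ℕ → List ℕ → List ℕ → List ℕ
shiftConcat p v u = map (p +_) v ++ u

-- Young tableaux as lists of rows (top row first)

Tableau : Set
Tableau = List (List ℕ)

rowIns : ℕ → List ℕ → Maybe ℕ × List ℕ
rowIns x [] = nothing , [ x ]
rowIns x (y ∷ ys) with x <? y
... | yes _ = just y , x ∷ ys
... | no  _ with rowIns x ys
...   | (b , r) = b , y ∷ r

insT : ℕ → Tableau → Tableau
insT x [] = [ [ x ] ]
insT x (r ∷ rs) with rowIns x r
... | (nothing , r') = r' ∷ rs
... | (just b , r') = r' ∷ insT b rs

P : List ℕ → Tableau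
P w = foldl (λ T x → insT x T) [] w

data Increasing : List ℕ → Set where
  inc[]  : Increasing []
  inc[x] : ∀ {x} → Increasing [ x ]
  inc∷   : ∀ {x y ys} → x < y → Increasing (y ∷ ys) → Increasing (x ∷ y ∷ ys)

data Below : List ℕ → List ℕ → Set where
  below[] : ∀ {r1} → Below r1 []
  below∷  : ∀ {x y r1 r2} → x < y → Below r1 r2 → Below (x ∷ r1) (y ∷ r2)

data RowsOK : Tableau → Set where
  rows[]  : RowsOK []
  rows[r] : ∀ {r} → Increasing r → RowsOK [ r ]
  rows∷   : ∀ {r1 r2 rs} → Increasing r1 → Below r1 r2 → RowsOK (r2 ∷ rs)
          → RowsOK (r1 ∷ r2 ∷ rs)

data NonEmptyRows : Tableau → Set where
  ne[] : NonEmptyRows []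
  ne∷  : ∀ {x r rs} → NonEmptyRows rs → NonEmptyRows ((x ∷ r) ∷ rs)

IsSYT : ℕ → Tableau → Set
IsSYT n T = NonEmptyRows T × RowsOK T × (concat T ↭ range1 n)

TaskinStep : ℕ → Tableau → Tableau → Set
TaskinStep n U V = ∃[ u ] ∃[ v ] (IsPerm n u × IsPerm n v × u ≤w v × P u ≡ U × P v ≡ V)

_≤T[_]_ : Tableau → ℕ → Tableau → Set
U ≤T[ n ] V = TransClosure (TaskinStep n) U V

module Submission where

-- Prefixing a fixed word, and appending a fixed word to the shifted copy v̄, preserve the weak order
-- on permutations: inversions inside a block are unchanged and the two blocks carry the same
-- letters. By Knuth's theorem P a = P b iff a and b are related by Knuth moves, which is a
-- congruence for concatenation and for the shift; so P(v̄u) depends only on P u and P v, and a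
-- Taskin chain from U to U' (resp. from V to V') lifts to one from V △ U to V △ U' (resp. from
-- V △ U' to V' △ U'). For Knuth's theorem, Knuth moves commute with row insertion row by row,
-- and every word is Knuth equivalent to the row reading word of its insertion tableau.

open import Defs
open import Data.Empty using (⊥-elim)
open import Data.Nat using (ℕ; zero; suc; _+_; _<_; _≤_; _<?_)
open import Data.Nat.Properties
open import Data.List using (List; []; _∷_; _++_; [_]; foldl; map; upTo)
open import Data.List.Properties
  using (foldl-++; ++-assoc; ++-identityʳ; map-++; ∷-injective; map-∘; map-cong; upTo-∷ʳ)
open import Data.List.Membership.Propositional using (_∈_)
open import Data.List.Membership.Propositional.Properties using (∈-∃++; ∈-map⁻; ∈-++⁻; ∈-++⁺ʳ)
open import Data.List.Relation.Unary.All as All using (All; []; _∷_)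
open import Data.List.Relation.Unary.AllPairs using (AllPairs; []; _∷_)
open import Data.List.Relation.Unary.Any using (here; there)
open import Data.List.Relation.Binary.Subset.Propositional using (_⊆_)
open import Data.List.Relation.Binary.Subset.Propositional.Properties using (⊆-reflexive-↭; map⁺)
open import Data.List.Relation.Binary.Permutation.Propositional
  using (↭-trans; ↭-sym; module PermutationReasoning)
open import Data.List.Relation.Binary.Permutation.Propositional.Properties
  using (++⁺) renaming (map⁺ to ↭-map⁺; ++-comm to ↭-++-comm)
open import Data.Maybe using (Maybe; just; nothing)
open import Data.Maybe.Relation.Unary.All as MaybeAll using (just; nothing)
open import Data.Maybe.Relation.Unary.Any as MaybeAny using (just)
open import Data.Product using (_×_; _,_; proj₁; proj₂; ∃₂; ∃-syntax)
open import Data.Sum using (_⊎_; inj₁; inj₂)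
open import Function using (_∘_)
open import Relation.Nullary using (yes; no)
open import Relation.Binary.PropositionalEquality hiding ([_])
open import Relation.Binary.Construct.Closure.Equivalence as EqClosure using (EqClosure)
import Relation.Binary.Construct.Closure.Transitive as TC
import Relation.Binary.Reasoning.Setoid as SetoidReasoning

toList : Maybe ℕ → List ℕ
toList nothing = []
toList (just b) = [ b ]

bumped : ℕ → List ℕ → Maybe ℕ
bumped x R = proj₁ (rowIns x R)

inserted : ℕ → List ℕ → List ℕ
inserted x R = proj₂ (rowIns x R)

Row : List ℕ → Set
Row = AllPairs _≤_

rowIns-< : ∀ {x r} R → x < r → rowIns x (r ∷ R) ≡ (just r , x ∷ R)
rowIns-< {x} {r} R x<r with x <? r
... | yes _ = refl
... | no x≮r = ⊥-elim (x≮r x<r)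

rowIns-≥ : ∀ {x r} R → r ≤ x → rowIns x (r ∷ R) ≡ (bumped x R , r ∷ inserted x R)
rowIns-≥ {x} {r} R r≤x with x <? r
... | yes x<r = ⊥-elim (≤⇒≯ r≤x x<r)
... | no _ = refl

bumped-> : ∀ x R → MaybeAll.All (x <_) (bumped x R)
bumped-> x [] = nothing
bumped-> x (r ∷ R) with <-≤-connex x r
... | inj₁ x<r rewrite rowIns-< R x<r = just x<r
... | inj₂ r≤x rewrite rowIns-≥ R r≤x = bumped-> x R

bumped-All : ∀ {P : ℕ → Set} x {R} → All P R → MaybeAll.All P (bumped x R)
bumped-All x [] = nothing
bumped-All x {r ∷ R} (pr ∷ pR) with <-≤-connex x r
... | inj₁ x<r rewrite rowIns-< R x<r = just pr
... | inj₂ r≤x rewrite rowIns-≥ R r≤x = bumped-All x pR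

inserted-All : ∀ {P : ℕ → Set} {x R} → All P R → P x → All P (inserted x R)
inserted-All [] px = px ∷ []
inserted-All {x = x} {r ∷ R} (pr ∷ pR) px with <-≤-connex x r
... | inj₁ x<r rewrite rowIns-< R x<r = px ∷ pR
... | inj₂ r≤x rewrite rowIns-≥ R r≤x = pr ∷ inserted-All pR px

inserted-Row : ∀ x {R} → Row R → Row (inserted x R)
inserted-Row x [] = [] ∷ []
inserted-Row x {r ∷ R} (r≤R ∷ rowR) with <-≤-connex x r
... | inj₁ x<r rewrite rowIns-< R x<r = All.map (<⇒≤ ∘ <-≤-trans x<r) r≤R ∷ rowR
... | inj₂ r≤x rewrite rowIns-≥ R r≤x = inserted-All r≤R r≤x ∷ inserted-Row x rowR

infix 4 _⊑_
data _⊑_ : Maybe ℕ → Maybe ℕ → Set where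
  ⊑-nothing : ∀ {b} → b ⊑ nothing
  ⊑-just    : ∀ {c d} → c ≤ d → just c ⊑ just d

just-⊑ : ∀ {c} b → MaybeAll.All (c ≤_) b → just c ⊑ b
just-⊑ nothing _ = ⊑-nothing
just-⊑ (just d) (just c≤d) = ⊑-just c≤d

bumped-⊑ : ∀ {y z R} → Row R → y ≤ z → bumped y R ⊑ bumped z (inserted y R)
bumped-⊑ {y} {z} {[]} _ y≤z rewrite rowIns-≥ [] y≤z = ⊑-nothing
bumped-⊑ {y} {z} {r ∷ R} (r≤R ∷ rowR) y≤z with <-≤-connex y r
... | inj₁ y<r rewrite rowIns-< R y<r | rowIns-≥ R y≤z = just-⊑ (bumped z R) (bumped-All z r≤R)
... | inj₂ r≤y rewrite rowIns-≥ R r≤y | rowIns-≥ (inserted y R) (≤-trans r≤y y≤z) = bumped-⊑ rowR y≤z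

bumped-≤-larger : ∀ {y z} R → y < z → MaybeAny.Any (_≤ z) (bumped y (inserted z R))
bumped-≤-larger {y} {z} [] y<z rewrite rowIns-< [] y<z = just ≤-refl
bumped-≤-larger {y} {z} (r ∷ R) y<z with <-≤-connex z r
... | inj₁ z<r rewrite rowIns-< R z<r | rowIns-< R y<z = just ≤-refl
... | inj₂ r≤z rewrite rowIns-≥ R r≤z with <-≤-connex y r
...   | inj₁ y<r rewrite rowIns-< (inserted z R) y<r = just r≤z
...   | inj₂ r≤y rewrite rowIns-≥ (inserted z R) r≤y = bumped-≤-larger R y<z

data KnuthMove : List ℕ → List ℕ → Set where
  knuth₁ : ∀ {x y z} → x < y → y ≤ z → KnuthMove (y ∷ z ∷ x ∷ []) (y ∷ x ∷ z ∷ [])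
  knuth₂ : ∀ {x y z} → x ≤ y → y < z → KnuthMove (x ∷ z ∷ y ∷ []) (z ∷ x ∷ y ∷ [])

knuth₁-maybe : ∀ {x y} b → x < y → MaybeAll.All (y ≤_) b
             → EqClosure KnuthMove (y ∷ toList b ++ [ x ]) (y ∷ x ∷ toList b ++ [])
knuth₁-maybe nothing _ _ = EqClosure.reflexive KnuthMove
knuth₁-maybe (just c) x<y (just y≤c) = EqClosure.return (knuth₁ x<y y≤c)

knuth₁-maybe₂ : ∀ {x} b₁ b₂ → b₁ ⊑ b₂ → MaybeAll.All (x <_) b₁
              → EqClosure KnuthMove (toList b₁ ++ toList b₂ ++ [ x ]) (toList b₁ ++ x ∷ toList b₂ ++ [])
knuth₁-maybe₂ b₁ nothing ⊑-nothing _ = EqClosure.reflexive KnuthMove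
knuth₁-maybe₂ (just c) (just d) (⊑-just c≤d) (just x<c) = EqClosure.return (knuth₁ x<c c≤d)

knuth₂-maybe : ∀ {x z} b₁ b₂ → MaybeAny.Any (_≤ z) b₂ → MaybeAll.All (z <_) b₁
             → MaybeAll.All (x ≤_) b₂
             → EqClosure KnuthMove (x ∷ toList b₁ ++ toList b₂ ++ []) (toList b₁ ++ x ∷ toList b₂ ++ [])
knuth₂-maybe nothing (just d) _ _ _ = EqClosure.reflexive KnuthMove
knuth₂-maybe (just c) (just d) (just d≤z) (just z<c) (just x≤d) =
  EqClosure.return (knuth₂ x≤d (≤-<-trans d≤z z<c))

rowInsWord : List ℕ → List ℕ → List ℕ × List ℕ
rowInsWord [] R = [] , R
rowInsWord (a ∷ w) R =
  toList (bumped a R) ++ proj₁ (rowInsWord w (inserted a R)) , proj₂ (rowInsWord w (inserted a R))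

-- The bumped letters of one row are inserted into the next, so this is the invariant that pushes a
-- Knuth move down through a tableau.
RowInsCompatible : List ℕ → List ℕ → List ℕ → Set
RowInsCompatible m m' R =
  proj₂ (rowInsWord m R) ≡ proj₂ (rowInsWord m' R)
  × EqClosure KnuthMove (proj₁ (rowInsWord m R)) (proj₁ (rowInsWord m' R))

rowInsWord-[]-resp-move : ∀ {m m'} → KnuthMove m m' → rowInsWord m [] ≡ rowInsWord m' []
rowInsWord-[]-resp-move (knuth₁ {z = z} x<y y≤z)
  rewrite rowIns-≥ [] y≤z | rowIns-< [ z ] x<y | rowIns-< [] x<y | rowIns-≥ [] (≤-trans (<⇒≤ x<y) y≤z)
  = refl
rowInsWord-[]-resp-move (knuth₂ {z = z} x≤y y<z)
  rewrite rowIns-≥ [] (≤-trans x≤y (<⇒≤ y<z)) | rowIns-≥ [ z ] x≤y | rowIns-< [] y<z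
        | rowIns-< [] (≤-<-trans x≤y y<z) | rowIns-≥ [] x≤y
  = refl

rowIns-compatible-[] : ∀ {m m'} → KnuthMove m m' → RowInsCompatible m m' []
rowIns-compatible-[] mv rewrite rowInsWord-[]-resp-move mv = refl , EqClosure.reflexive KnuthMove

rowIns-compatible-knuth₁ : ∀ {x y z} R → Row R → x < y → y ≤ z
                         → RowInsCompatible (y ∷ z ∷ x ∷ []) (y ∷ x ∷ z ∷ []) R
rowIns-compatible-knuth₁ [] _ x<y y≤z = rowIns-compatible-[] (knuth₁ x<y y≤z)
rowIns-compatible-knuth₁ {x} {y} {z} (r ∷ R) (r≤R ∷ rowR) x<y y≤z with <-≤-connex x r
... | inj₂ r≤x
  rewrite rowIns-≥ R (≤-trans r≤x (<⇒≤ x<y))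
        | rowIns-≥ (inserted y R) (≤-trans r≤x (<⇒≤ (<-≤-trans x<y y≤z)))
        | rowIns-≥ (inserted z (inserted y R)) r≤x
        | rowIns-≥ (inserted y R) r≤x
        | rowIns-≥ (inserted x (inserted y R)) (≤-trans r≤x (<⇒≤ (<-≤-trans x<y y≤z)))
  = let (rows , bumps) = rowIns-compatible-knuth₁ R rowR x<y y≤z in cong (r ∷_) rows , bumps
... | inj₁ x<r with <-≤-connex y r
...   | inj₁ y<r
  rewrite rowIns-< R y<r | rowIns-≥ R y≤z | rowIns-< (inserted z R) x<y | rowIns-< R x<y
        | rowIns-≥ R (≤-trans (<⇒≤ x<y) y≤z)
  = refl , knuth₁-maybe (bumped z R) y<r (bumped-All z r≤R)
...   | inj₂ r≤y
  rewrite rowIns-≥ R r≤y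
        | rowIns-≥ (inserted y R) (≤-trans r≤y y≤z)
        | rowIns-< (inserted z (inserted y R)) x<r
        | rowIns-< (inserted y R) x<r
        | rowIns-≥ (inserted y R) (≤-trans (<⇒≤ x<y) y≤z)
  = refl , knuth₁-maybe₂ (bumped y R) (bumped z (inserted y R)) (bumped-⊑ rowR y≤z)
                         (MaybeAll.map (≤-<-trans r≤y) (bumped-> y R))

rowIns-compatible-knuth₂ : ∀ {x y z} R → Row R → x ≤ y → y < z
                         → RowInsCompatible (x ∷ z ∷ y ∷ []) (z ∷ x ∷ y ∷ []) R
rowIns-compatible-knuth₂ [] _ x≤y y<z = rowIns-compatible-[] (knuth₂ x≤y y<z)
rowIns-compatible-knuth₂ {x} {y} {z} (r ∷ R) (r≤R ∷ rowR) x≤y y<z with <-≤-connex x r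
... | inj₂ r≤x
  rewrite rowIns-≥ R r≤x
        | rowIns-≥ (inserted x R) (≤-trans r≤x (≤-trans x≤y (<⇒≤ y<z)))
        | rowIns-≥ (inserted z (inserted x R)) (≤-trans r≤x x≤y)
        | rowIns-≥ R (≤-trans r≤x (≤-trans x≤y (<⇒≤ y<z)))
        | rowIns-≥ (inserted z R) r≤x
        | rowIns-≥ (inserted x (inserted z R)) (≤-trans r≤x x≤y)
  = let (rows , bumps) = rowIns-compatible-knuth₂ R rowR x≤y y<z in cong (r ∷_) rows , bumps
... | inj₁ x<r with <-≤-connex z r
...   | inj₂ r≤z
  rewrite rowIns-< R x<r
        | rowIns-≥ R (≤-trans x≤y (<⇒≤ y<z))
        | rowIns-≥ (inserted z R) x≤y
        | rowIns-≥ R r≤z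
        | rowIns-< (inserted z R) x<r
        | rowIns-≥ (inserted z R) x≤y
  = refl , knuth₂-maybe (bumped z R) (bumped y (inserted z R)) (bumped-≤-larger R y<z) (bumped-> z R)
                        (bumped-All y (inserted-All r≤R r≤z))
rowIns-compatible-knuth₂ {x} {y} {z} (r ∷ []) _ x≤y y<z | inj₁ x<r | inj₁ z<r
  rewrite rowIns-< [] x<r | rowIns-≥ [] (≤-trans x≤y (<⇒≤ y<z)) | rowIns-≥ [ z ] x≤y | rowIns-< [] y<z
        | rowIns-< [] z<r | rowIns-< [] (≤-<-trans x≤y y<z) | rowIns-≥ [] x≤y
  = refl , EqClosure.reflexive KnuthMove
-- Both words leave x y in front of S; they bump r, s, z and r, z, s respectively.
rowIns-compatible-knuth₂ {x} {y} {z} (r ∷ s ∷ S) ((r≤s ∷ _) ∷ _) x≤y y<z | inj₁ x<r | inj₁ z<r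
  rewrite rowIns-< (s ∷ S) x<r
        | rowIns-≥ (s ∷ S) (≤-trans x≤y (<⇒≤ y<z))
        | rowIns-< S (<-≤-trans z<r r≤s)
        | rowIns-≥ (z ∷ S) x≤y
        | rowIns-< S y<z
        | rowIns-< (s ∷ S) z<r
        | rowIns-< (s ∷ S) (≤-<-trans x≤y y<z)
        | rowIns-≥ (s ∷ S) x≤y
        | rowIns-< S (<-trans y<z (<-≤-trans z<r r≤s))
  = refl , EqClosure.return (knuth₁ z<r r≤s)

rowIns-compatible : ∀ {m m'} R → Row R → KnuthMove m m' → RowInsCompatible m m' R
rowIns-compatible R rowR (knuth₁ x<y y≤z) = rowIns-compatible-knuth₁ R rowR x<y y≤z
rowIns-compatible R rowR (knuth₂ x≤y y<z) = rowIns-compatible-knuth₂ R rowR x≤y y<z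

insertAll : Tableau → List ℕ → Tableau
insertAll = foldl (λ T x → insT x T)

insT-∷ : ∀ a r rs → insT a (r ∷ rs) ≡ inserted a r ∷ insertAll rs (toList (bumped a r))
insT-∷ a r rs with rowIns a r
... | (nothing , _) = refl
... | (just _ , _) = refl

insertAll-∷ : ∀ w r rs
            → insertAll (r ∷ rs) w ≡ proj₂ (rowInsWord w r) ∷ insertAll rs (proj₁ (rowInsWord w r))
insertAll-∷ [] r rs = refl
insertAll-∷ (a ∷ w) r rs rewrite insT-∷ a r rs
  | insertAll-∷ w (inserted a r) (insertAll rs (toList (bumped a r)))
  | foldl-++ (λ T x → insT x T) rs (toList (bumped a r)) (proj₁ (rowInsWord w (inserted a r))) = refl

insT-Rows : ∀ a {T} → All Row T → All Row (insT a T)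
insT-Rows a [] = ([] ∷ []) ∷ []
insT-Rows a {r ∷ rs} (rowR ∷ rowsRs) with rowIns a r | inserted-Row a rowR
... | (nothing , _) | rowR' = rowR' ∷ rowsRs
... | (just b , _)  | rowR' = rowR' ∷ insT-Rows b rowsRs

insertAll-Rows : ∀ w {T} → All Row T → All Row (insertAll T w)
insertAll-Rows [] rows = rows
insertAll-Rows (a ∷ w) rows = insertAll-Rows w (insT-Rows a rows)

insertAll-[[]]-resp-move : ∀ {m m'} → KnuthMove m m' → insertAll [ [] ] m ≡ insertAll [ [] ] m'
insertAll-[[]]-resp-move {m} {m'} mv = begin
  insertAll [ [] ] m
    ≡⟨ insertAll-∷ m [] [] ⟩
  proj₂ (rowInsWord m []) ∷ insertAll [] (proj₁ (rowInsWord m []))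
    ≡⟨ cong (λ (bs , r) → r ∷ insertAll [] bs) (rowInsWord-[]-resp-move mv) ⟩
  proj₂ (rowInsWord m' []) ∷ insertAll [] (proj₁ (rowInsWord m' []))
    ≡⟨ insertAll-∷ m' [] [] ⟨
  insertAll [ [] ] m'
    ∎
  where open ≡-Reasoning

-- On the empty tableau the first letter of a move opens a row, exactly as in the tableau [ [] ].
insertAll-resp-move : ∀ T → All Row T → ∀ {m m'} → KnuthMove m m' → insertAll T m ≡ insertAll T m'
insertAll-resp-move [] [] mv@(knuth₁ _ _) = insertAll-[[]]-resp-move mv
insertAll-resp-move [] [] mv@(knuth₂ _ _) = insertAll-[[]]-resp-move mv
insertAll-resp-move (r ∷ rs) (rowR ∷ rowsRs) {m} {m'} mv with rowIns-compatible r rowR mv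
... | (rows , bumps) = begin
  insertAll (r ∷ rs) m                                              ≡⟨ insertAll-∷ m r rs ⟩
  proj₂ (rowInsWord m r) ∷ insertAll rs (proj₁ (rowInsWord m r))
    ≡⟨ cong₂ _∷_ rows (insertAll-resp-moves bumps) ⟩
  proj₂ (rowInsWord m' r) ∷ insertAll rs (proj₁ (rowInsWord m' r))   ≡⟨ insertAll-∷ m' r rs ⟨
  insertAll (r ∷ rs) m'                                             ∎
  where
  open ≡-Reasoning
  insertAll-resp-moves : ∀ {a b} → EqClosure KnuthMove a b → insertAll rs a ≡ insertAll rs b
  insertAll-resp-moves = EqClosure.gfold isEquivalence (insertAll rs) (insertAll-resp-move rs rowsRs)

data KnuthStep : List ℕ → List ℕ → Set where
  knuthStep : ∀ xs ys {m m'} → KnuthMove m m' → KnuthStep (xs ++ m ++ ys) (xs ++ m' ++ ys)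

infix 4 _≈K_
_≈K_ : List ℕ → List ℕ → Set
_≈K_ = EqClosure KnuthStep

knuth : ∀ xs ys {m m'} → KnuthMove m m' → (xs ++ m ++ ys) ≈K (xs ++ m' ++ ys)
knuth xs ys mv = EqClosure.return (knuthStep xs ys mv)

≈K-refl : ∀ {w} → w ≈K w
≈K-refl = EqClosure.reflexive KnuthStep

≈K-trans : ∀ {a b c} → a ≈K b → b ≈K c → a ≈K c
≈K-trans = EqClosure.transitive KnuthStep

≈K-reflexive : ∀ {a b} → a ≡ b → a ≈K b
≈K-reflexive refl = ≈K-refl

≈K-++⁺ˡ : ∀ L {a b} → a ≈K b → (L ++ a) ≈K (L ++ b)
≈K-++⁺ˡ L = EqClosure.gmap (L ++_) step
  where
  step : ∀ {a b} → KnuthStep a b → KnuthStep (L ++ a) (L ++ b)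
  step (knuthStep xs ys {m} {m'} mv) =
    subst₂ KnuthStep (++-assoc L xs (m ++ ys)) (++-assoc L xs (m' ++ ys)) (knuthStep (L ++ xs) ys mv)

≈K-++⁺ʳ : ∀ R {a b} → a ≈K b → (a ++ R) ≈K (b ++ R)
≈K-++⁺ʳ R = EqClosure.gmap (_++ R) step
  where
  reassoc : ∀ xs m ys → xs ++ m ++ (ys ++ R) ≡ (xs ++ m ++ ys) ++ R
  reassoc xs m ys = trans (cong (xs ++_) (sym (++-assoc m ys R))) (sym (++-assoc xs (m ++ ys) R))
  step : ∀ {a b} → KnuthStep a b → KnuthStep (a ++ R) (b ++ R)
  step (knuthStep xs ys {m} {m'} mv) =
    subst₂ KnuthStep (reassoc xs m ys) (reassoc xs m' ys) (knuthStep xs (ys ++ R) mv)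

KnuthMove-map-+ : ∀ p {m m'} → KnuthMove m m' → KnuthMove (map (p +_) m) (map (p +_) m')
KnuthMove-map-+ p (knuth₁ x<y y≤z) = knuth₁ (+-monoʳ-< p x<y) (+-monoʳ-≤ p y≤z)
KnuthMove-map-+ p (knuth₂ x≤y y<z) = knuth₂ (+-monoʳ-≤ p x≤y) (+-monoʳ-< p y<z)

≈K-map-+ : ∀ p {a b} → a ≈K b → map (p +_) a ≈K map (p +_) b
≈K-map-+ p = EqClosure.gmap (map (p +_)) step
  where
  map-++₃ : ∀ xs m ys → map (p +_) xs ++ map (p +_) m ++ map (p +_) ys ≡ map (p +_) (xs ++ m ++ ys)
  map-++₃ xs m ys = sym (trans (map-++ (p +_) xs (m ++ ys)) (cong (map (p +_) xs ++_) (map-++ (p +_) m ys)))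
  step : ∀ {a b} → KnuthStep a b → KnuthStep (map (p +_) a) (map (p +_) b)
  step (knuthStep xs ys {m} {m'} mv) =
    subst₂ KnuthStep (map-++₃ xs m ys) (map-++₃ xs m' ys)
           (knuthStep (map (p +_) xs) (map (p +_) ys) (KnuthMove-map-+ p mv))

insertAll-resp-≈K : ∀ T → All Row T → ∀ {a b} → a ≈K b → insertAll T a ≡ insertAll T b
insertAll-resp-≈K T rows = EqClosure.gfold isEquivalence (insertAll T) step
  where
  step : ∀ {a b} → KnuthStep a b → insertAll T a ≡ insertAll T b
  step (knuthStep xs ys {m} {m'} mv) = begin
    insertAll T (xs ++ m ++ ys)                     ≡⟨ foldl-++ _ T xs (m ++ ys) ⟩
    insertAll (insertAll T xs) (m ++ ys)            ≡⟨ foldl-++ _ (insertAll T xs) m ys ⟩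
    insertAll (insertAll (insertAll T xs) m) ys
      ≡⟨ cong (λ T' → insertAll T' ys) (insertAll-resp-move _ (insertAll-Rows xs rows) mv) ⟩
    insertAll (insertAll (insertAll T xs) m') ys    ≡⟨ foldl-++ _ (insertAll T xs) m' ys ⟨
    insertAll (insertAll T xs) (m' ++ ys)           ≡⟨ foldl-++ _ T xs (m' ++ ys) ⟨
    insertAll T (xs ++ m' ++ ys)                    ∎
    where open ≡-Reasoning

P-resp-≈K : ∀ {a b} → a ≈K b → P a ≡ P b
P-resp-≈K = insertAll-resp-≈K [] []

reading : Tableau → List ℕ
reading [] = []
reading (r ∷ rs) = reading rs ++ r

≈K-sink : ∀ {x r} R → x < r → All (r ≤_) R → Row R → (r ∷ R ++ [ x ]) ≈K (r ∷ x ∷ R)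
≈K-sink [] _ _ _ = ≈K-refl
≈K-sink {x} {r} (s ∷ S) x<r (r≤s ∷ _) (s≤S ∷ rowS) =
  ≈K-trans (≈K-++⁺ˡ [ r ] (≈K-sink S (<-≤-trans x<r r≤s) s≤S rowS)) (knuth [] S (knuth₁ x<r r≤s))

inserted-head : ∀ x R → ∃₂ λ y S → inserted x R ≡ y ∷ S × y ≤ x
inserted-head x [] = x , [] , refl , ≤-refl
inserted-head x (r ∷ R) with <-≤-connex x r
... | inj₁ x<r rewrite rowIns-< R x<r = x , R , refl , ≤-refl
... | inj₂ r≤x rewrite rowIns-≥ R r≤x = r , inserted x R , refl , r≤x

≈K-bump-past : ∀ {r x} b R → MaybeAll.All (x <_) b → All (r ≤_) R → (∃₂ λ y S → R ≡ y ∷ S × y ≤ x)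
             → (r ∷ toList b ++ R) ≈K (toList b ++ r ∷ R)
≈K-bump-past nothing _ _ _ _ = ≈K-refl
≈K-bump-past (just c) _ (just x<c) (r≤y ∷ _) (y , S , refl , y≤x) =
  knuth [] S (knuth₂ r≤y (≤-<-trans y≤x x<c))

rowIns-≈K : ∀ x {R} → Row R → (R ++ [ x ]) ≈K (toList (bumped x R) ++ inserted x R)
rowIns-≈K x [] = ≈K-refl
rowIns-≈K x {r ∷ R} (r≤R ∷ rowR) with <-≤-connex x r
... | inj₁ x<r rewrite rowIns-< R x<r = ≈K-sink R x<r r≤R rowR
... | inj₂ r≤x rewrite rowIns-≥ R r≤x =
  ≈K-trans (≈K-++⁺ˡ [ r ] (rowIns-≈K x rowR))
           (≈K-bump-past (bumped x R) (inserted x R) (bumped-> x R) (inserted-All r≤R r≤x) (inserted-head x R))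

module ≈K-Reasoning = SetoidReasoning (EqClosure.setoid KnuthStep)

reading-insT : ∀ x {T} → All Row T → (reading T ++ [ x ]) ≈K reading (insT x T)
reading-insT x [] = ≈K-refl
reading-insT x {r ∷ rs} (rowR ∷ rowsRs) with rowIns x r | rowIns-≈K x rowR
... | (nothing , r') | r+x≈r' = begin
  (reading rs ++ r) ++ [ x ]   ≡⟨ ++-assoc (reading rs) r [ x ] ⟩
  reading rs ++ r ++ [ x ]     ≈⟨ ≈K-++⁺ˡ (reading rs) r+x≈r' ⟩
  reading rs ++ r'             ∎
  where open ≈K-Reasoning
... | (just b , r')  | r+x≈br' = begin
  (reading rs ++ r) ++ [ x ]   ≡⟨ ++-assoc (reading rs) r [ x ] ⟩
  reading rs ++ r ++ [ x ]     ≈⟨ ≈K-++⁺ˡ (reading rs) r+x≈br' ⟩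
  reading rs ++ b ∷ r'         ≡⟨ ++-assoc (reading rs) [ b ] r' ⟨
  (reading rs ++ [ b ]) ++ r'  ≈⟨ ≈K-++⁺ʳ r' (reading-insT b rowsRs) ⟩
  reading (insT b rs) ++ r'    ∎
  where open ≈K-Reasoning

reading-insertAll : ∀ w {T} → All Row T → (reading T ++ w) ≈K reading (insertAll T w)
reading-insertAll [] {T} _ = ≈K-reflexive (++-identityʳ (reading T))
reading-insertAll (a ∷ w) {T} rows = begin
  reading T ++ a ∷ w              ≡⟨ ++-assoc (reading T) [ a ] w ⟨
  (reading T ++ [ a ]) ++ w       ≈⟨ ≈K-++⁺ʳ w (reading-insT a rows) ⟩
  reading (insT a T) ++ w         ≈⟨ reading-insertAll w (insT-Rows a rows) ⟩
  reading (insertAll T (a ∷ w))   ∎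
  where open ≈K-Reasoning

P≡P⇒≈K : ∀ {a b} → P a ≡ P b → a ≈K b
P≡P⇒≈K {a} {b} Pa≡Pb = begin
  a                ≈⟨ reading-insertAll a [] ⟩
  reading (P a)    ≡⟨ cong reading Pa≡Pb ⟩
  reading (P b)    ≈⟨ reading-insertAll b [] ⟨
  b                ∎
  where open ≈K-Reasoning

Precedes : List ℕ → ℕ → ℕ → Set
Precedes w c d = ∃[ xs ] ∃[ ys ] ∃[ zs ] (w ≡ xs ++ c ∷ ys ++ d ∷ zs)

Precedes-++⁻ : ∀ L R {c d} → Precedes (L ++ R) c d → Precedes L c d ⊎ Precedes R c d ⊎ (c ∈ L × d ∈ R)
Precedes-++⁻ [] R c≺d = inj₂ (inj₁ c≺d)
Precedes-++⁻ (l ∷ L) R {c} {d} ([] , ys , zs , eq) with ∷-injective eq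
... | (refl , L++R≡ys++d∷zs) with ∈-++⁻ L (subst (d ∈_) (sym L++R≡ys++d∷zs) (∈-++⁺ʳ ys (here refl)))
...   | inj₂ d∈R = inj₂ (inj₂ (here refl , d∈R))
...   | inj₁ d∈L with ∈-∃++ d∈L
...     | (ys' , zs' , refl) = inj₁ ([] , ys' , zs' , refl)
Precedes-++⁻ (l ∷ L) R ((x ∷ xs) , ys , zs , eq) with ∷-injective eq
... | (refl , eq') with Precedes-++⁻ L R (xs , ys , zs , eq')
...   | inj₁ (xs' , ys' , zs' , e) = inj₁ (l ∷ xs' , ys' , zs' , cong (l ∷_) e)
...   | inj₂ (inj₁ c≺d)          = inj₂ (inj₁ c≺d)
...   | inj₂ (inj₂ (c∈L , d∈R))  = inj₂ (inj₂ (there c∈L , d∈R))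

Precedes-++⁺ˡ : ∀ {L} R {c d} → Precedes L c d → Precedes (L ++ R) c d
Precedes-++⁺ˡ R {c} {d} (xs , ys , zs , refl) =
  xs , ys , zs ++ R , trans (++-assoc xs (c ∷ ys ++ d ∷ zs) R) (cong (λ t → xs ++ c ∷ t) (++-assoc ys (d ∷ zs) R))

Precedes-++⁺ʳ : ∀ L {R c d} → Precedes R c d → Precedes (L ++ R) c d
Precedes-++⁺ʳ L {c = c} {d} (xs , ys , zs , refl) = L ++ xs , ys , zs , sym (++-assoc L xs (c ∷ ys ++ d ∷ zs))

Precedes-++⁺ : ∀ L R {c d} → c ∈ L → d ∈ R → Precedes (L ++ R) c d
Precedes-++⁺ L R {c} {d} c∈L d∈R with ∈-∃++ c∈L | ∈-∃++ d∈R
... | (l₁ , l₂ , refl) | (r₁ , r₂ , refl) =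
  l₁ , l₂ ++ r₁ , r₂ ,
  trans (++-assoc l₁ (c ∷ l₂) (r₁ ++ d ∷ r₂)) (cong (λ t → l₁ ++ c ∷ t) (sym (++-assoc l₂ r₁ (d ∷ r₂))))

Precedes-map⁻ : ∀ (f : ℕ → ℕ) L {c d} → Precedes (map f L) c d
              → ∃₂ λ c' d' → c ≡ f c' × d ≡ f d' × Precedes L c' d'
Precedes-map⁻ f [] ([] , _ , _ , ())
Precedes-map⁻ f [] ((_ ∷ _) , _ , _ , ())
Precedes-map⁻ f (l ∷ L) {c} {d} ([] , ys , zs , eq) with ∷-injective eq
... | (c≡fl , eq') with ∈-map⁻ f (subst (d ∈_) (sym eq') (∈-++⁺ʳ ys (here refl)))
...   | (d' , d'∈L , d≡fd') with ∈-∃++ d'∈L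
...     | (ys' , zs' , refl) = l , d' , sym c≡fl , d≡fd' , ([] , ys' , zs' , refl)
Precedes-map⁻ f (l ∷ L) ((x ∷ xs) , ys , zs , eq) with ∷-injective eq
... | (_ , eq') with Precedes-map⁻ f L (xs , ys , zs , eq')
...   | (c' , d' , c≡fc' , d≡fd' , (xs' , ys' , zs' , e)) =
  c' , d' , c≡fc' , d≡fd' , (l ∷ xs' , ys' , zs' , cong (l ∷_) e)

Precedes-map⁺ : ∀ (f : ℕ → ℕ) {L c d} → Precedes L c d → Precedes (map f L) (f c) (f d)
Precedes-map⁺ f {c = c} {d} (xs , ys , zs , refl) =
  map f xs , map f ys , map f zs ,
  trans (map-++ f xs (c ∷ ys ++ d ∷ zs)) (cong (λ t → map f xs ++ f c ∷ t) (map-++ f ys (d ∷ zs)))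

≤w-++⁺ˡ : ∀ L {a b} → a ⊆ b → a ≤w b → (L ++ a) ≤w (L ++ b)
≤w-++⁺ˡ L {a} {b} a⊆b a≤b c d (d<c , c≺d) with Precedes-++⁻ L a c≺d
... | inj₁ c≺d∈L = d<c , Precedes-++⁺ˡ b c≺d∈L
... | inj₂ (inj₁ c≺d∈a) = d<c , Precedes-++⁺ʳ L (proj₂ (a≤b c d (d<c , c≺d∈a)))
... | inj₂ (inj₂ (c∈L , d∈a)) = d<c , Precedes-++⁺ L b c∈L (a⊆b d∈a)

≤w-++⁺ʳ : ∀ R {a b} → a ⊆ b → a ≤w b → (a ++ R) ≤w (b ++ R)
≤w-++⁺ʳ R {a} {b} a⊆b a≤b c d (d<c , c≺d) with Precedes-++⁻ a R c≺d
... | inj₁ c≺d∈a = d<c , Precedes-++⁺ˡ R (proj₂ (a≤b c d (d<c , c≺d∈a)))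
... | inj₂ (inj₁ c≺d∈R) = d<c , Precedes-++⁺ʳ b c≺d∈R
... | inj₂ (inj₂ (c∈a , d∈R)) = d<c , Precedes-++⁺ b R (a⊆b c∈a) d∈R

≤w-map-+ : ∀ p {a b} → a ≤w b → map (p +_) a ≤w map (p +_) b
≤w-map-+ p {a} a≤b c d (d<c , c≺d) with Precedes-map⁻ (p +_) a c≺d
... | (c' , d' , refl , refl , c'≺d') =
  d<c , Precedes-map⁺ (p +_) (proj₂ (a≤b c' d' (+-cancelˡ-< p d' c' d<c , c'≺d')))

IsPerm-⊆ : ∀ {n a b} → IsPerm n a → IsPerm n b → a ⊆ b
IsPerm-⊆ perm-a perm-b = ⊆-reflexive-↭ (↭-trans perm-a (↭-sym perm-b))

upTo-+ : ∀ p q → upTo (p + q) ≡ upTo p ++ map (p +_) (upTo q)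
upTo-+ p zero rewrite +-identityʳ p = sym (++-identityʳ (upTo p))
upTo-+ p (suc q) = begin
  upTo (p + suc q)                               ≡⟨ cong upTo (+-suc p q) ⟩
  upTo (suc (p + q))                             ≡⟨ upTo-∷ʳ (p + q) ⟨
  upTo (p + q) ++ [ p + q ]                      ≡⟨ cong (_++ [ p + q ]) (upTo-+ p q) ⟩
  (upTo p ++ map (p +_) (upTo q)) ++ [ p + q ]   ≡⟨ ++-assoc (upTo p) _ _ ⟩
  upTo p ++ map (p +_) (upTo q) ++ [ p + q ]     ≡⟨ cong (upTo p ++_) (map-++ (p +_) (upTo q) [ q ]) ⟨
  upTo p ++ map (p +_) (upTo q ++ [ q ])         ≡⟨ cong (λ t → upTo p ++ map (p +_) t) (upTo-∷ʳ q) ⟩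
  upTo p ++ map (p +_) (upTo (suc q))            ∎
  where open ≡-Reasoning

range1-+ : ∀ p q → range1 (p + q) ≡ range1 p ++ map (p +_) (range1 q)
range1-+ p q = begin
  map suc (upTo (p + q))                          ≡⟨ cong (map suc) (upTo-+ p q) ⟩
  map suc (upTo p ++ map (p +_) (upTo q))         ≡⟨ map-++ suc (upTo p) _ ⟩
  range1 p ++ map suc (map (p +_) (upTo q))       ≡⟨ cong (range1 p ++_) (map-∘ (upTo q)) ⟨
  range1 p ++ map (suc ∘ (p +_)) (upTo q)         ≡⟨ cong (range1 p ++_) (map-cong (sym ∘ +-suc p) (upTo q)) ⟩
  range1 p ++ map ((p +_) ∘ suc) (upTo q)         ≡⟨ cong (range1 p ++_) (map-∘ (upTo q)) ⟩
  range1 p ++ map (p +_) (range1 q)               ∎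
  where open ≡-Reasoning

shiftConcat-IsPerm : ∀ {p q v u} → IsPerm q v → IsPerm p u → IsPerm (p + q) (shiftConcat p v u)
shiftConcat-IsPerm {p} {q} {v} {u} perm-v perm-u = begin
  map (p +_) v ++ u                    ↭⟨ ++⁺ (↭-map⁺ (p +_) perm-v) perm-u ⟩
  map (p +_) (range1 q) ++ range1 p    ↭⟨ ↭-++-comm (map (p +_) (range1 q)) (range1 p) ⟩
  range1 p ++ map (p +_) (range1 q)    ≡⟨ range1-+ p q ⟨
  range1 (p + q)                       ∎
  where open PermutationReasoning

shiftConcat-≤w-congʳ : ∀ p v {a b} → a ⊆ b → a ≤w b → shiftConcat p v a ≤w shiftConcat p v b
shiftConcat-≤w-congʳ p v = ≤w-++⁺ˡ (map (p +_) v)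

shiftConcat-≤w-congˡ : ∀ p u {a b} → a ⊆ b → a ≤w b → shiftConcat p a u ≤w shiftConcat p b u
shiftConcat-≤w-congˡ p u a⊆b = ≤w-++⁺ʳ u (map⁺ (p +_) a⊆b) ∘ ≤w-map-+ p

shiftConcat-P-congʳ : ∀ p v a b → P a ≡ P b → P (shiftConcat p v a) ≡ P (shiftConcat p v b)
shiftConcat-P-congʳ p v a b Pa≡Pb = P-resp-≈K (≈K-++⁺ˡ (map (p +_) v) (P≡P⇒≈K {a} {b} Pa≡Pb))

shiftConcat-P-congˡ : ∀ p u a b → P a ≡ P b → P (shiftConcat p a u) ≡ P (shiftConcat p b u)
shiftConcat-P-congˡ p u a b Pa≡Pb = P-resp-≈K (≈K-++⁺ʳ u (≈K-map-+ p (P≡P⇒≈K {a} {b} Pa≡Pb)))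

module _ {m n} (F : List ℕ → List ℕ)
         (F-IsPerm : ∀ {w} → IsPerm m w → IsPerm n (F w))
         (F-≤w : ∀ {a b} → a ⊆ b → a ≤w b → F a ≤w F b)
         (F-P : ∀ a b → P a ≡ P b → P (F a) ≡ P (F b)) where

  TaskinStep-lift : ∀ {U U'} u u' → TaskinStep m U U' → P u ≡ U → P u' ≡ U' → TaskinStep n (P (F u)) (P (F u'))
  TaskinStep-lift u u' (a , b , perm-a , perm-b , a≤b , refl , refl) Pu≡Pa Pu'≡Pb =
    F a , F b , F-IsPerm perm-a , F-IsPerm perm-b , F-≤w (IsPerm-⊆ perm-a perm-b) a≤b ,
    F-P a u (sym Pu≡Pa) , F-P b u' (sym Pu'≡Pb)

  ≤T-lift : ∀ {U U'} u u' → U ≤T[ m ] U' → P u ≡ U → P u' ≡ U' → P (F u) ≤T[ n ] P (F u')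
  ≤T-lift u u' TC.[ U≤U' ] Pu≡U Pu'≡U' = TC.[ TaskinStep-lift u u' U≤U' Pu≡U Pu'≡U' ]
  ≤T-lift u u' (U≤W@(_ , w , _ , _ , _ , _ , refl) TC.∷ W≤U') Pu≡U Pu'≡U' =
    TaskinStep-lift u w U≤W Pu≡U refl TC.∷ ≤T-lift w u' W≤U' refl Pu'≡U'

shiftConcat-≤T-congʳ : ∀ {p q U U'} v u u' → IsPerm q v → U ≤T[ p ] U' → P u ≡ U → P u' ≡ U'
                     → P (shiftConcat p v u) ≤T[ p + q ] P (shiftConcat p v u')
shiftConcat-≤T-congʳ {p} v u u' perm-v =
  ≤T-lift (shiftConcat p v) (shiftConcat-IsPerm perm-v)
          (shiftConcat-≤w-congʳ p v) (shiftConcat-P-congʳ p v) u u'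

shiftConcat-≤T-congˡ : ∀ {p q V V'} u v v' → IsPerm p u → V ≤T[ q ] V' → P v ≡ V → P v' ≡ V'
                     → P (shiftConcat p v u) ≤T[ p + q ] P (shiftConcat p v' u)
shiftConcat-≤T-congˡ {p} u v v' perm-u =
  ≤T-lift (λ w → shiftConcat p w u) (λ perm-w → shiftConcat-IsPerm perm-w perm-u)
          (shiftConcat-≤w-congˡ p u) (shiftConcat-P-congˡ p u) v v'

lemma4p2 : (p q : ℕ) (U U' V V' : Tableau)
    → IsSYT p U → IsSYT p U' → IsSYT q V → IsSYT q V'
    → U ≤T[ p ] U' → V ≤T[ q ] V'
    → (u u' v v' : List ℕ)
    → IsPerm p u → IsPerm p u' → IsPerm q v → IsPerm q v'
    → P u ≡ U → P u' ≡ U' → P v ≡ V → P v' ≡ V'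
    → P (shiftConcat p v u) ≤T[ p + q ] P (shiftConcat p v' u')
lemma4p2 p q U U' V V' _ _ _ _ U≤U' V≤V' u u' v v' _ perm-u' perm-v _ Pu≡U Pu'≡U' Pv≡V Pv'≡V' =
  shiftConcat-≤T-congʳ v u u' perm-v U≤U' Pu≡U Pu'≡U'
  TC.++ shiftConcat-≤T-congˡ u' v v' perm-u' V≤V' Pv≡V Pv'≡V'
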